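{- Let $(\vec G=(V,E),\sigma)$ be a binary-explainable best match graph with $|V|\ge 2$, and let $\mathscr V$ be the partition of $V$ into the vertex sets of the connected components of the Aho graph $[\mathscr R^{\mathrm B}(\vec G,\sigma),V]$. Then every coarse-graining $\mathscr V'$ of $\mathscr V$ with $|\mathscr V'|\ge 2$ satisfies $c(\vec G,\mathscr V')=0$.
   Context: A digraph $\vec G=(V,E)$ has a finite vertex set and arc set $E\subseteq (V\times V)\setminus\{(v,v)\mid v\in V\}$. A partition $\mathscr V'$ of $V$ is a coarse-graining of a partition $\mathscr V$ if every set of $\mathscr V$ is contained in some set of $\mathscr V'$. All rooted trees are phylogenetic (every non-leaf vertex has at least two children); a tree is binary if every non-leaf vertex has exactly two children; $L(T)$ is the leaf set, $\rho_T$ the root, $T(v)$ the subtree rooted at $v$, $\mathrm{child}_T(v)$ the children of $v$; $u\preceq_T v$ means $v$ lies on the path from $u$ to the root; $\mathrm{lca}_T$ is the last common ancestor. For a tree $T$ with leaf coloring $\sigma$, a leaf $y$ is a best match of a leaf $x$ if $\sigma(x)\ne\sigma(y)$ and $\mathrm{lca}_T(x,y)\preceq_T\mathrm{lca}_T(x,y')$ for all leaves $y'$ with $\sigma(y')=\sigma(y)$; the best match graph $\vec G(T,\sigma)$ has vertex set $L(T)$, coloring $\sigma$, and arcs $(x,y)$ whenever $y$ is a best match of $x$. A properly colored digraph is a binary-explainable best match graph if it equals $\vec G(T,\sigma)$ for some binary tree $T$. A triple $xy|z$ on distinct leaves is displayed by $T$ if $\mathrm{lca}_T(x,y)\prec_T\mathrm{lca}_T(x,z)$.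 Informative triples: $\mathscr R(\vec G,\sigma)=\{ab|b'\colon \sigma(a)\ne\sigma(b)=\sigma(b'),\ (a,b)\in E,\ (a,b')\notin E\}$; forbidden triples: $\mathscr F(\vec G,\sigma)=\{ab|b'\colon \sigma(a)\ne\sigma(b)=\sigma(b'),\ b\ne b',\ (a,b),(a,b')\in E\}$; $\mathscr R^{\mathrm B}(\vec G,\sigma)=\mathscr R(\vec G,\sigma)\cup\{bb'|a\colon ab|b'\in\mathscr F(\vec G,\sigma)\}$. For a triple set $\mathscr R$, the Aho graph $[\mathscr R,V]$ is the undirected graph on $V$ with edge $xy$ iff $xy|z\in\mathscr R$ for some $z\in V$. For a tree $T$ with $L(T)=V$, $U(\vec G,T)=E\triangle E(\vec G(T,\sigma))$; for a partition $\mathscr V$ of $V$ with $|\mathscr V|\ge 2$, $\mathscr T(\mathscr V)$ is the set of phylogenetic trees $T$ with $L(T)=V$ and $\{L(T(v))\mid v\in\mathrm{child}_T(\rho_T)\}=\mathscr V$, $U(\vec G,\mathscr V)=\bigcap_{T\in\mathscr T(\mathscr V)}U(\vec G,T)$, and $c(\vec G,\mathscr V)=|U(\vec G,\mathscr V)|$. -}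

module Defs where

open import Data.Nat using (ℕ; zero; suc; _≤_; _≟_)
open import Data.Fin using (Fin)
open import Data.List using (List; []; _∷_; _++_; length; allFin)
open import Data.List.Relation.Unary.All using (All)
open import Data.List.Membership.Propositional using (_∈_)
open import Data.List.Relation.Binary.Permutation.Propositional using (_↭_)
open import Data.List.Relation.Binary.Prefix.Heterogeneous using (Prefix)
open import Data.Product using (Σ; ∃; _×_)
open import Data.Sum using (_⊎_)
open import Relation.Nullary using (¬_; yes; no)
open import Relation.Binary.PropositionalEquality using (_≡_; _≢_)
open import Relation.Binary.Construct.Closure.ReflexiveTransitive using (Star)

-- A vertex of a tree is identified with its address (list of child
-- indices from the root).  u ⪯_T v  iff  the address of v is a prefix
-- of the address of u.

data Tree (n : ℕ) : Set where
  leaf : Fin n → Tree n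
  node : List (Tree n) → Tree n

module _ {n : ℕ} where

  children : Tree n → List (Tree n)
  children (leaf _)  = []
  children (node ts) = ts

  mutual
    leaves : Tree n → List (Fin n)
    leaves (leaf x)  = x ∷ []
    leaves (node ts) = leaves* ts

    leaves* : List (Tree n) → List (Fin n)
    leaves* []       = []
    leaves* (t ∷ ts) = leaves t ++ leaves* ts

  data Phylo : Tree n → Set where
    leafP : ∀ {x} → Phylo (leaf x)
    nodeP : ∀ {ts} → 2 ≤ length ts → All Phylo ts → Phylo (node ts)

  data Binary : Tree n → Set where
    leafB : ∀ {x} → Binary (leaf x)
    nodeB : ∀ {ts} → length ts ≡ 2 → All Binary ts → Binary (node ts)

  OnV : Tree n → Set
  OnV T = leaves T ↭ allFin n

  data ChildAt : List (Tree n) → ℕ → Tree n → Set where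
    at-zero : ∀ {t ts} → ChildAt (t ∷ ts) zero t
    at-suc  : ∀ {s ts i t} → ChildAt ts i t → ChildAt (s ∷ ts) (suc i) t

  data LeafAt : Tree n → Fin n → List ℕ → Set where
    here  : ∀ {x} → LeafAt (leaf x) x []
    there : ∀ {ts i t x p} → ChildAt ts i t → LeafAt t x p →
            LeafAt (node ts) x (i ∷ p)

-- longest common prefix of two addresses = address of the lca
lcp : List ℕ → List ℕ → List ℕ
lcp (a ∷ as) (b ∷ bs) with a ≟ b
... | yes _ = a ∷ lcp as bs
... | no  _ = []
lcp _ _ = []

_⪯_ : List ℕ → List ℕ → Set
u ⪯ v = Prefix _≡_ v u

module _ {n : ℕ} where

  LcaLe : Tree n → Fin n → Fin n → Fin n → Set
  LcaLe T x y y' = ∀ {p q q'} → LeafAt T x p → LeafAt T y q → LeafAt T y' q' →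
                   lcp p q ⪯ lcp p q'

  BestMatch : {C : Set} → Tree n → (Fin n → C) → Fin n → Fin n → Set
  BestMatch T σ x y = σ x ≢ σ y × (∀ y' → σ y' ≡ σ y → LcaLe T x y y')

  SameArcs : (Fin n → Fin n → Set) → (Fin n → Fin n → Set) → Set
  SameArcs E F = ∀ x y → (E x y → F x y) × (F x y → E x y)

  IsDigraph : (Fin n → Fin n → Set) → Set
  IsDigraph E = ∀ x → ¬ E x x

  ProperlyColoured : {C : Set} → (Fin n → Fin n → Set) → (Fin n → C) → Set
  ProperlyColoured E σ = ∀ x y → E x y → σ x ≢ σ y

  BinaryBMG : {C : Set} → (Fin n → Fin n → Set) → (Fin n → C) → Set
  BinaryBMG E σ = IsDigraph E × ProperlyColoured E σ ×
    Σ (Tree n) (λ T → Phylo T × Binary T × OnV T × SameArcs E (BestMatch T σ))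

  Informative : {C : Set} → (Fin n → Fin n → Set) → (Fin n → C) →
                Fin n → Fin n → Fin n → Set
  Informative E σ a b b' = σ a ≢ σ b × σ b ≡ σ b' × E a b × ¬ E a b'

  Forbidden : {C : Set} → (Fin n → Fin n → Set) → (Fin n → C) →
              Fin n → Fin n → Fin n → Set
  Forbidden E σ a b b' = σ a ≢ σ b × σ b ≡ σ b' × b ≢ b' × E a b × E a b'

  -- the triple xy|z (= yx|z) belongs to R^B(G,σ)
  InRB : {C : Set} → (Fin n → Fin n → Set) → (Fin n → C) →
         Fin n → Fin n → Fin n → Set
  InRB E σ x y z = Informative E σ x y z ⊎ Informative E σ y x z
                 ⊎ Forbidden E σ z x y ⊎ Forbidden E σ z y x

  AhoEdge : {C : Set} → (Fin n → Fin n → Set) → (Fin n → C) → Fin n → Fin n → Set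
  AhoEdge E σ x y = ∃ λ z → InRB E σ x y z

  -- x and y lie in the same connected component of the Aho graph
  -- (the edge relation is symmetric, so Star gives connectivity)
  AhoConnected : {C : Set} → (Fin n → Fin n → Set) → (Fin n → C) → Fin n → Fin n → Set
  AhoConnected E σ = Star (AhoEdge E σ)

  -- A partition V' of V into k blocks is represented by a surjective
  -- block map f : V → Fin k; its blocks are the fibres f⁻¹(i).
  Surj : {k : ℕ} → (Fin n → Fin k) → Set
  Surj f = ∀ i → ∃ λ x → f x ≡ i

  CoarseGrains : {k : ℕ} → (Fin n → Fin k) → (Fin n → Fin n → Set) → Set
  CoarseGrains f R = ∀ x y → R x y → f x ≡ f y

  LeafSetIs : {k : ℕ} → Tree n → (Fin n → Fin k) → Fin k → Set
  LeafSetIs t f i = ∀ x → (x ∈ leaves t → f x ≡ i) × (f x ≡ i → x ∈ leaves t)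

  InTV : {k : ℕ} → (Fin n → Fin k) → Tree n → Set
  InTV f T = Phylo T × OnV T
           × (∀ t → t ∈ children T → ∃ λ i → LeafSetIs t f i)
           × (∀ i → ∃ λ t → t ∈ children T × LeafSetIs t f i)

  InU : {C : Set} → (Fin n → Fin n → Set) → (Fin n → C) → Tree n →
        Fin n → Fin n → Set
  InU E σ T x y = (E x y × ¬ BestMatch T σ x y) ⊎ (¬ E x y × BestMatch T σ x y)

  InUV : {C : Set} {k : ℕ} → (Fin n → Fin n → Set) → (Fin n → C) →
         (Fin n → Fin k) → Fin n → Fin n → Set
  InUV E σ f x y = ∀ T → InTV f T → InU E σ T x y

  CostZero : {C : Set} {k : ℕ} → (Fin n → Fin n → Set) → (Fin n → C) →
             (Fin n → Fin k) → Set
  CostZero E σ f = ∀ x y → ¬ InUV E σ f x y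

-- For every pair (x, y) we exhibit a tree T ∈ 𝒯(V') on which the arcs of G and the best
-- matches of T agree at (x, y); hence U(G, V') is empty.  Such a T hangs one block tree per
-- class of V' below its root; the block tree of a class puts two chosen vertices into a
-- cherry and the others directly below its root.
--
-- If (x, y) is an arc, put x and y into a cherry (when they share a class).  A vertex y' of
-- colour σ(y) outside the class of x would yield an informative triple xy|y' or a forbidden
-- triple xy|y', joining x with y or y with y' in the Aho graph; so y is a best match of x.
-- If (x, y) is not an arc and σ(x) ≠ σ(y), the best match graph has an arc (x, m) with
-- σ(m) = σ(y), and the informative triple xm|y puts x and m into one class.  With x and m in
-- a cherry, m is strictly closer to x than y is, so y is not a best match of x.
module Submission where

open import Defs
open import Data.Nat as ℕ using (ℕ; zero; suc; _≤_; _<_; _∸_; _≤?_)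
open import Data.Nat.Properties
  using (≰⇒>; <-≤-trans; <-irrefl; ≤-trans; ≤-refl; ≤-pred; ∸-monoʳ-<; m∸n≡0⇒m≤n; n≤0⇒n≡0)
open import Data.Fin as Fin using (Fin; toℕ; _≟_)
open import Data.Fin.Properties using (toℕ-injective; suc-injective)
open import Data.List using (List; []; _∷_; _++_; length; allFin; tabulate; filter; map; concat)
open import Data.List.Properties using (tabulate-cong; length-tabulate; map-tabulate; filter-accept; filter-reject)
open import Data.List.Relation.Unary.All using (All; []; _∷_; lookup)
open import Data.List.Relation.Unary.All.Properties using (++⁻ˡ; ++⁻ʳ; tabulate⁺)
open import Data.List.Relation.Unary.Any using (here; there; tail)
open import Data.List.Relation.Unary.Unique.Propositional using (Unique; []; _∷_)
import Data.List.Relation.Unary.Unique.Propositional.Properties as Unique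
open import Data.List.Membership.Propositional using (_∈_; _∉_)
open import Data.List.Membership.Propositional.Properties
  using (∈-++⁺ˡ; ∈-++⁺ʳ; ∈-++⁻; ∈-∃++; ∈-allFin; ∈-filter⁺; ∈-filter⁻; ∈-tabulate⁺; ∈-tabulate⁻)
open import Data.List.Relation.Binary.Permutation.Propositional
  using (_↭_; prep; ↭-refl; ↭-sym; ↭-trans; ↭-reflexive; ↭⇒↭ₛ; module PermutationReasoning)
open import Data.List.Relation.Binary.Permutation.Propositional.Properties using (∈-resp-↭; shift; ++⁺ˡ)
import Data.List.Relation.Binary.Permutation.Setoid.Properties as PermutationSetoid
import Data.List.Relation.Binary.Pointwise as Pointwise
open import Data.List.Relation.Binary.Prefix.Heterogeneous using ([]; _∷_)
open import Data.List.Relation.Binary.Prefix.Heterogeneous.Properties using (length-mono; fromPointwise)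
open import Data.Product using (Σ; ∃; _×_; _,_; proj₁; proj₂)
open import Data.Sum using (inj₁; inj₂; [_,_]′)
open import Data.Empty using (⊥; ⊥-elim)
open import Function using (_∘_)
open import Relation.Nullary using (¬_; Dec; yes; no)
open import Relation.Nullary.Negation using (¬¬-map)
open import Relation.Nullary.Decidable using (¬¬-excluded-middle)
open import Relation.Binary.PropositionalEquality
  using (_≡_; _≢_; refl; sym; trans; cong; cong₂; subst; subst₂; setoid; module ≡-Reasoning)
open import Relation.Binary.Construct.Closure.ReflexiveTransitive using (ε; _◅_)

Unique-++⁻ˡ : ∀ {A : Set} (xs : List A) {ys} → Unique (xs ++ ys) → Unique xs
Unique-++⁻ˡ []       _            = []
Unique-++⁻ˡ (x ∷ xs) (x∉ ∷ uniq) = ++⁻ˡ xs x∉ ∷ Unique-++⁻ˡ xs uniq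

Unique-++⁻ʳ : ∀ {A : Set} (xs : List A) {ys} → Unique (xs ++ ys) → Unique ys
Unique-++⁻ʳ []       uniq       = uniq
Unique-++⁻ʳ (x ∷ xs) (_ ∷ uniq) = Unique-++⁻ʳ xs uniq

Unique-++⇒disjoint : ∀ {A : Set} (xs : List A) {ys v} → Unique (xs ++ ys) → v ∈ xs → v ∉ ys
Unique-++⇒disjoint (x ∷ xs) (x∉ ∷ _)    (here refl) v∈ys = lookup (++⁻ʳ xs x∉) v∈ys refl
Unique-++⇒disjoint (x ∷ xs) (_  ∷ uniq) (there v∈xs)     = Unique-++⇒disjoint xs uniq v∈xs

↭-allFin⇒Unique : ∀ {n} {xs : List (Fin n)} → xs ↭ allFin n → Unique xs
↭-allFin⇒Unique {n} xs↭ =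
  PermutationSetoid.Unique-resp-↭ (setoid _) (↭⇒↭ₛ (↭-sym xs↭)) (Unique.allFin⁺ n)

∈⇒↭∷ : ∀ {A : Set} {v : A} {xs} → v ∈ xs → ∃ λ ys → xs ↭ v ∷ ys
∈⇒↭∷ v∈xs with ys , zs , refl ← ∈-∃++ v∈xs = ys ++ zs , shift _ ys zs

listing-starting-with : ∀ {n} {x w : Fin n} → x ≢ w → ∃ λ R → x ∷ w ∷ R ↭ allFin n
listing-starting-with {n} {x} {w} x≢w
  with ys , all↭x∷ys ← ∈⇒↭∷ (∈-allFin x)
  with zs , ys↭w∷zs ← ∈⇒↭∷ (tail (x≢w ∘ sym) (∈-resp-↭ all↭x∷ys (∈-allFin w)))
  = zs , ↭-sym (↭-trans all↭x∷ys (prep x ys↭w∷zs))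

concat-tabulate-[] : ∀ {A : Set} k → concat (tabulate {n = k} (λ _ → [] {A = A})) ≡ []
concat-tabulate-[] zero    = refl
concat-tabulate-[] (suc k) = concat-tabulate-[] k

concat-tabulate-insert : ∀ {A : Set} {k} (xss yss : Fin k → List A) (i : Fin k) (a : A) →
                         yss i ≡ a ∷ xss i → (∀ j → j ≢ i → yss j ≡ xss j) →
                         concat (tabulate yss) ↭ a ∷ concat (tabulate xss)
concat-tabulate-insert xss yss Fin.zero a yssᵢ yssⱼ =
  ↭-reflexive (cong₂ _++_ yssᵢ (cong concat (tabulate-cong (λ j → yssⱼ (Fin.suc j) λ ()))))
concat-tabulate-insert xss yss (Fin.suc i) a yssᵢ yssⱼ = begin
  yss Fin.zero ++ concat (tabulate (yss ∘ Fin.suc))  ≡⟨ cong (_++ _) (yssⱼ Fin.zero λ ()) ⟩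
  xss Fin.zero ++ concat (tabulate (yss ∘ Fin.suc))  ↭⟨ ++⁺ˡ (xss Fin.zero) inserted ⟩
  xss Fin.zero ++ a ∷ concat (tabulate (xss ∘ Fin.suc)) ↭⟨ shift a (xss Fin.zero) _ ⟩
  a ∷ concat (tabulate xss)                          ∎
  where
  open PermutationReasoning
  inserted : concat (tabulate (yss ∘ Fin.suc)) ↭ a ∷ concat (tabulate (xss ∘ Fin.suc))
  inserted = concat-tabulate-insert (xss ∘ Fin.suc) (yss ∘ Fin.suc) i a yssᵢ
               (λ j j≢i → yssⱼ (Fin.suc j) (j≢i ∘ suc-injective))

concat-tabulate-filter : ∀ {A : Set} {k} (g : A → Fin k) xs →
                         concat (tabulate (λ j → filter (λ z → g z ≟ j) xs)) ↭ xs
concat-tabulate-filter {k = k} g []       = ↭-reflexive (concat-tabulate-[] k)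
concat-tabulate-filter {k = k} g (a ∷ xs) =
  ↭-trans (concat-tabulate-insert (block xs) (block (a ∷ xs)) (g a) a
             (filter-accept (λ z → g z ≟ g a) refl)
             (λ j j≢ga → filter-reject (λ z → g z ≟ j) (j≢ga ∘ sym)))
          (prep a (concat-tabulate-filter g xs))
  where
  block : List _ → Fin k → List _
  block ys j = filter (λ z → g z ≟ j) ys

module _ {n : ℕ} where

  ∈-leaves*⁺ : ∀ {ts i t x} → ChildAt ts i t → x ∈ leaves {n} t → x ∈ leaves* ts
  ∈-leaves*⁺ at-zero            x∈t = ∈-++⁺ˡ x∈t
  ∈-leaves*⁺ (at-suc {s = s} c) x∈t = ∈-++⁺ʳ (leaves s) (∈-leaves*⁺ c x∈t)

  Unique-child : ∀ {ts i t} → ChildAt ts i t → Unique (leaves* {n} ts) → Unique (leaves t)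
  Unique-child (at-zero {t = t}) uniq = Unique-++⁻ˡ (leaves t) uniq
  Unique-child (at-suc {s = s} c) uniq = Unique-child c (Unique-++⁻ʳ (leaves s) uniq)

  LeafAt⇒∈ : ∀ {t x p} → LeafAt {n} t x p → x ∈ leaves t
  LeafAt⇒∈ here        = here refl
  LeafAt⇒∈ (there c l) = ∈-leaves*⁺ c (LeafAt⇒∈ l)

  mutual
    ∈⇒LeafAt : ∀ t {x} → x ∈ leaves {n} t → ∃ (LeafAt t x)
    ∈⇒LeafAt (leaf y)  (here refl) = [] , here
    ∈⇒LeafAt (node ts) x∈ts with i , t , p , c , l ← ∈⇒LeafAt* ts x∈ts = i ∷ p , there c l

    ∈⇒LeafAt* : ∀ ts {x} → x ∈ leaves* {n} ts →
                Σ ℕ λ i → Σ (Tree n) λ t → Σ (List ℕ) λ p → ChildAt ts i t × LeafAt t x p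
    ∈⇒LeafAt* (t ∷ ts) x∈ with ∈-++⁻ (leaves t) x∈
    ... | inj₁ x∈t  = let p , l = ∈⇒LeafAt t x∈t in zero , t , p , at-zero , l
    ... | inj₂ x∈ts = let i , t′ , p , c , l = ∈⇒LeafAt* ts x∈ts in suc i , t′ , p , at-suc c , l

  leaves*≡concat-map : ∀ ts → leaves* {n} ts ≡ concat (map leaves ts)
  leaves*≡concat-map []       = refl
  leaves*≡concat-map (t ∷ ts) = cong (leaves t ++_) (leaves*≡concat-map ts)

  ChildAt-tabulate⁻ : ∀ {k} (h : Fin k → Tree n) {i t} → ChildAt (tabulate h) i t →
                      Σ (Fin k) λ j → toℕ j ≡ i × t ≡ h j
  ChildAt-tabulate⁻ {suc k} h at-zero = Fin.zero , refl , refl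
  ChildAt-tabulate⁻ {suc k} h (at-suc c) with j , refl , refl ← ChildAt-tabulate⁻ (h ∘ Fin.suc) c =
    Fin.suc j , refl , refl

  ChildAt-unique : ∀ {ts i j t s x} → Unique (leaves* {n} ts) → ChildAt ts i t → ChildAt ts j s →
                   x ∈ leaves t → x ∈ leaves s → i ≡ j × t ≡ s
  ChildAt-unique _ at-zero at-zero _ _ = refl , refl
  ChildAt-unique {ts = t ∷ _} uniq at-zero (at-suc c) x∈t x∈s =
    ⊥-elim (Unique-++⇒disjoint (leaves t) uniq x∈t (∈-leaves*⁺ c x∈s))
  ChildAt-unique {ts = s ∷ _} uniq (at-suc c) at-zero x∈t x∈s =
    ⊥-elim (Unique-++⇒disjoint (leaves s) uniq x∈s (∈-leaves*⁺ c x∈t))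
  ChildAt-unique {ts = s ∷ _} uniq (at-suc c) (at-suc c′) x∈t x∈s
    with refl , refl ← ChildAt-unique (Unique-++⁻ʳ (leaves s) uniq) c c′ x∈t x∈s = refl , refl

  LeafAt-unique : ∀ {t x p q} → Unique (leaves {n} t) → LeafAt t x p → LeafAt t x q → p ≡ q
  LeafAt-unique uniq here        here          = refl
  LeafAt-unique uniq (there c l) (there c′ l′)
    with refl , refl ← ChildAt-unique uniq c c′ (LeafAt⇒∈ l) (LeafAt⇒∈ l′) =
    cong (_ ∷_) (LeafAt-unique (Unique-child c uniq) l l′)

  OnV⇒Unique : ∀ T → OnV {n} T → Unique (leaves T)
  OnV⇒Unique T = ↭-allFin⇒Unique

  OnV⇒LeafAt : ∀ T → OnV {n} T → ∀ u → ∃ (LeafAt T u)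
  OnV⇒LeafAt T onV u = ∈⇒LeafAt T (∈-resp-↭ (↭-sym onV) (∈-allFin u))

⪯-refl : ∀ p → p ⪯ p
⪯-refl p = fromPointwise (Pointwise.refl refl)

lcp-⪯ˡ : ∀ p q → p ⪯ lcp p q
lcp-⪯ˡ []       _        = []
lcp-⪯ˡ (a ∷ p) []        = []
lcp-⪯ˡ (a ∷ p) (b ∷ q) with a ℕ.≟ b
... | yes _ = refl ∷ lcp-⪯ˡ p q
... | no  _ = []

⪯-by-length : ∀ {p a b} → p ⪯ a → p ⪯ b → length b ≤ length a → a ⪯ b
⪯-by-length _              []             _              = []
⪯-by-length (refl ∷ p⪯a) (refl ∷ p⪯b) (ℕ.s≤s b≤a) = refl ∷ ⪯-by-length p⪯a p⪯b b≤a

lcp-∷-≡ : ∀ a p q → lcp (a ∷ p) (a ∷ q) ≡ a ∷ lcp p q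
lcp-∷-≡ a p q with a ℕ.≟ a
... | yes _   = refl
... | no  a≢a = ⊥-elim (a≢a refl)

lcp-∷-≢ : ∀ {a b} p q → a ≢ b → lcp (a ∷ p) (b ∷ q) ≡ []
lcp-∷-≢ {a} {b} p q a≢b with a ℕ.≟ b
... | yes a≡b = ⊥-elim (a≢b a≡b)
... | no  _   = refl

¬¬-maximum : ∀ {A : Set} (P : A → Set) (d : A → ℕ) {bound} → (∀ a → d a ≤ bound) →
             ∀ {a} → P a → ¬ ¬ (Σ A λ m → P m × (∀ a → P a → d a ≤ d m))
¬¬-maximum {A} P d {bound} d≤bound = climb _ ≤-refl
  where
  climb : ∀ s {a} → bound ∸ d a ≤ s → P a → ¬ ¬ (Σ A λ m → P m × (∀ a → P a → d a ≤ d m))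
  climb s {a} gap Pa no-maximum = no-maximum (a , Pa , dominated)
    where
    exceeds : ∀ s {a′} → bound ∸ d a ≤ s → d a < d a′ → P a′ → ⊥
    exceeds zero    gap a<a′ _   =
      <-irrefl refl (<-≤-trans a<a′ (≤-trans (d≤bound _) (m∸n≡0⇒m≤n (n≤0⇒n≡0 gap))))
    exceeds (suc s) gap a<a′ Pa′ =
      climb s (≤-pred (≤-trans (∸-monoʳ-< a<a′ (d≤bound _)) gap)) Pa′ no-maximum
    dominated : ∀ a′ → P a′ → d a′ ≤ d a
    dominated a′ Pa′ with d a′ ≤? d a
    ... | yes a′≤a = a′≤a
    ... | no  a′≰a = ⊥-elim (exceeds s gap (≰⇒> a′≰a) Pa′)

-- Only classically: colours lie in an arbitrary type, so colour classes are not decidable.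
best-match-exists : ∀ {n} {C : Set} (T : Tree n) (σ : Fin n → C) → OnV T →
                    ∀ x y → σ x ≢ σ y → ¬ ¬ (Σ (Fin n) λ m → σ m ≡ σ y × BestMatch T σ x m)
best-match-exists {n} T σ onV x y σx≢σy =
  ¬¬-map best (¬¬-maximum (λ u → σ u ≡ σ y) depth
                           (λ u → length-mono (lcp-⪯ˡ (address x) (address u))) refl)
  where
  address : Fin n → List ℕ
  address u = proj₁ (OnV⇒LeafAt T onV u)

  depth : Fin n → ℕ
  depth u = length (lcp (address x) (address u))

  canonical : ∀ {u p} → LeafAt T u p → p ≡ address u
  canonical l = LeafAt-unique (OnV⇒Unique T onV) l (proj₂ (OnV⇒LeafAt T onV _))

  best : (Σ (Fin n) λ m → σ m ≡ σ y × (∀ u → σ u ≡ σ y → depth u ≤ depth m)) →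
         Σ (Fin n) λ m → σ m ≡ σ y × BestMatch T σ x m
  best (m , σm≡σy , deepest) = m , σm≡σy , (λ σx≡σm → σx≢σy (trans σx≡σm σm≡σy)) , lca-lowest
    where
    lca-lowest : ∀ y′ → σ y′ ≡ σ m → LcaLe T x m y′
    lca-lowest y′ σy′≡σm lx lm ly′
      rewrite canonical lx | canonical lm | canonical ly′ =
      ⪯-by-length (lcp-⪯ˡ (address x) (address m)) (lcp-⪯ˡ (address x) (address y′))
                  (deepest y′ (trans σy′≡σm σm≡σy))

closer⇒¬BestMatch : ∀ {n} {C : Set} {T : Tree n} (σ : Fin n → C) → OnV T → ∀ {x y m} → σ m ≡ σ y →
                    (∀ {p q r} → LeafAt T x p → LeafAt T y q → LeafAt T m r → ¬ (lcp p q ⪯ lcp p r)) →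
                    ¬ BestMatch T σ x y
closer⇒¬BestMatch {T = T} σ onV {x} {y} {m} σm≡σy closer (_ , lca-lowest) =
  closer (at x) (at y) (at m) (lca-lowest m σm≡σy (at x) (at y) (at m))
  where
  at : ∀ u → LeafAt T u (proj₁ (OnV⇒LeafAt T onV u))
  at u = proj₂ (OnV⇒LeafAt T onV u)

module _ {n : ℕ} where

  cherry : Fin n → Fin n → Tree n
  cherry a b = node (leaf a ∷ leaf b ∷ [])

  -- The value on [] is junk: the blocks of a partition are nonempty.
  blockTree : List (Fin n) → Tree n
  blockTree []              = node []
  blockTree (a ∷ [])        = leaf a
  blockTree (a ∷ b ∷ [])    = cherry a b
  blockTree (a ∷ b ∷ c ∷ r) = node (cherry a b ∷ map leaf (c ∷ r))

  leaves*-map-leaf : ∀ r → leaves* (map (leaf {n}) r) ≡ r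
  leaves*-map-leaf []      = refl
  leaves*-map-leaf (a ∷ r) = cong (a ∷_) (leaves*-map-leaf r)

  leaves-blockTree : ∀ l → leaves (blockTree l) ≡ l
  leaves-blockTree []              = refl
  leaves-blockTree (a ∷ [])        = refl
  leaves-blockTree (a ∷ b ∷ [])    = refl
  leaves-blockTree (a ∷ b ∷ c ∷ r) = cong (λ r′ → a ∷ b ∷ c ∷ r′) (leaves*-map-leaf r)

  Phylo-blockTree : ∀ l {z} → z ∈ l → Phylo (blockTree l)
  Phylo-blockTree (a ∷ [])        _ = leafP
  Phylo-blockTree (a ∷ b ∷ [])    _ = nodeP (ℕ.s≤s (ℕ.s≤s ℕ.z≤n)) (leafP ∷ leafP ∷ [])
  Phylo-blockTree (a ∷ b ∷ c ∷ r) _ =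
    nodeP (ℕ.s≤s (ℕ.s≤s ℕ.z≤n)) (Phylo-blockTree (a ∷ b ∷ []) (here refl) ∷ leaves-Phylo (c ∷ r))
    where
    leaves-Phylo : ∀ r → All Phylo (map (leaf {n}) r)
    leaves-Phylo []      = []
    leaves-Phylo (_ ∷ r) = leafP ∷ leaves-Phylo r

  Unique-blockTree : ∀ {l} → Unique l → Unique (leaves (blockTree l))
  Unique-blockTree {l} = subst Unique (sym (leaves-blockTree l))

  blockTree-cherry : ∀ {x w u : Fin n} {r px pw pu} → Unique (x ∷ w ∷ r) → u ≢ x → u ≢ w →
                     let t = blockTree (x ∷ w ∷ r) in
                     LeafAt t x px → LeafAt t w pw → LeafAt t u pu →
                     lcp px pw ≡ 0 ∷ [] × lcp px pu ≡ []
  blockTree-cherry {r = []} _ u≢x _   _ _ (there at-zero here)          = ⊥-elim (u≢x refl)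
  blockTree-cherry {r = []} _ _   u≢w _ _ (there (at-suc at-zero) here) = ⊥-elim (u≢w refl)
  blockTree-cherry {r = c ∷ r} _ u≢x _ _ _ (there at-zero (there at-zero here)) = ⊥-elim (u≢x refl)
  blockTree-cherry {r = c ∷ r} _ _ u≢w _ _ (there at-zero (there (at-suc at-zero) here)) =
    ⊥-elim (u≢w refl)
  blockTree-cherry {x} {w} {r = c ∷ r} uniq _ _ lx lw (there (at-suc _) _)
    rewrite LeafAt-unique (Unique-blockTree uniq) lx (there at-zero (there at-zero here))
          | LeafAt-unique (Unique-blockTree uniq) lw (there at-zero (there (at-suc at-zero) here)) =
    refl , refl

module PartitionTree {n k : ℕ} (f : Fin n → Fin k) (O : List (Fin n)) where

  block : Fin k → List (Fin n)
  block j = filter (λ z → f z ≟ j) O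

  tree : Tree n
  tree = node (tabulate (blockTree ∘ block))

  ∈-block⁻ : ∀ {j z} → z ∈ leaves (blockTree (block j)) → f z ≡ j
  ∈-block⁻ {j} z∈ =
    proj₂ (∈-filter⁻ (λ z → f z ≟ j) {xs = O} (subst (_ ∈_) (leaves-blockTree (block j)) z∈))

  ∈-block⁺ : ∀ {z} → z ∈ O → z ∈ leaves (blockTree (block (f z)))
  ∈-block⁺ {z} z∈O = subst (z ∈_) (sym (leaves-blockTree _)) (∈-filter⁺ (λ u → f u ≟ f z) z∈O refl)

  leaves-tree : leaves tree ≡ concat (tabulate block)
  leaves-tree = begin
    leaves* (tabulate (blockTree ∘ block))
      ≡⟨ leaves*≡concat-map (tabulate (blockTree ∘ block)) ⟩
    concat (map leaves (tabulate (blockTree ∘ block)))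
      ≡⟨ cong concat (map-tabulate (blockTree ∘ block) leaves) ⟩
    concat (tabulate (leaves ∘ blockTree ∘ block))
      ≡⟨ cong concat (tabulate-cong (leaves-blockTree ∘ block)) ⟩
    concat (tabulate block)
      ∎
    where open ≡-Reasoning

  tree-OnV : O ↭ allFin n → OnV tree
  tree-OnV O↭ = ↭-trans (↭-reflexive leaves-tree) (↭-trans (concat-tabulate-filter f O) O↭)

  tree-∈𝒯 : Surj f → 2 ≤ k → O ↭ allFin n → InTV f tree
  tree-∈𝒯 surj 2≤k O↭ =
    nodeP (subst (2 ≤_) (sym (length-tabulate _)) 2≤k) (tabulate⁺ phylo) , tree-OnV O↭ , fibre , block-child
    where
    ∈O : ∀ z → z ∈ O
    ∈O z = ∈-resp-↭ (↭-sym O↭) (∈-allFin z)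

    block-is-fibre : ∀ j → LeafSetIs (blockTree (block j)) f j
    block-is-fibre j z =
      ∈-block⁻ , λ fz≡j → subst (λ i → z ∈ leaves (blockTree (block i))) fz≡j (∈-block⁺ (∈O z))

    phylo : ∀ j → Phylo (blockTree (block j))
    phylo j with z , fz≡j ← surj j = Phylo-blockTree (block j) (∈-filter⁺ (λ u → f u ≟ j) (∈O z) fz≡j)

    fibre : ∀ t → t ∈ children tree → ∃ λ j → LeafSetIs t f j
    fibre t t∈ with j , refl ← ∈-tabulate⁻ t∈ = j , block-is-fibre j

    block-child : ∀ j → ∃ λ t → t ∈ children tree × LeafSetIs t f j
    block-child j = _ , ∈-tabulate⁺ j , block-is-fibre j

  address-in-block : ∀ {u j p} → LeafAt tree u p → f u ≡ j →
                     ∃ λ p′ → p ≡ toℕ j ∷ p′ × LeafAt (blockTree (block j)) u p′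
  address-in-block (there c l) refl with _ , refl , refl ← ChildAt-tabulate⁻ _ c
    with refl ← ∈-block⁻ (LeafAt⇒∈ l) = _ , refl , l

  different-blocks-meet-at-root : ∀ {u v p q} → f u ≢ f v → LeafAt tree u p → LeafAt tree v q → lcp p q ≡ []
  different-blocks-meet-at-root fu≢fv lu lv
    with p′ , refl , _ ← address-in-block lu refl
    with q′ , refl , _ ← address-in-block lv refl = lcp-∷-≢ p′ q′ (fu≢fv ∘ toℕ-injective)

  other-block-farther : ∀ {x u v p q r} → f x ≢ f u → f x ≡ f v →
                        LeafAt tree x p → LeafAt tree u q → LeafAt tree v r → ¬ (lcp p q ⪯ lcp p r)
  other-block-farther {x} fx≢fu fx≡fv lx lu lv
    with p′ , refl , _ ← address-in-block lx refl
    with r′ , refl , _ ← address-in-block lv (sym fx≡fv)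
    rewrite different-blocks-meet-at-root fx≢fu lx lu | lcp-∷-≡ (toℕ (f x)) p′ r′ = λ ()

module _ {n k : ℕ} (f : Fin n → Fin k) {x w : Fin n} (R : List (Fin n)) where

  open PartitionTree f

  block-cherry : f w ≡ f x → block (x ∷ w ∷ R) (f x) ≡ x ∷ w ∷ block R (f x)
  block-cherry fw≡fx =
    trans (filter-accept (λ z → f z ≟ f x) refl) (cong (x ∷_) (filter-accept (λ z → f z ≟ f x) fw≡fx))

  blockTree-block-cherry : ∀ {u px pw pu} → Unique (x ∷ w ∷ R) → f w ≡ f x → u ≢ x → u ≢ w →
                           let t = blockTree (block (x ∷ w ∷ R) (f x)) in
                           LeafAt t x px → LeafAt t w pw → LeafAt t u pu →
                           lcp px pw ≡ 0 ∷ [] × lcp px pu ≡ []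
  blockTree-block-cherry uniq fw≡fx u≢x u≢w lx lw lu
    with uniq′ ← Unique.filter⁺ (λ z → f z ≟ f x) uniq
    rewrite block-cherry fw≡fx = blockTree-cherry uniq′ u≢x u≢w lx lw lu

  cherry-below : ∀ {u p q r} → Unique (x ∷ w ∷ R) → f w ≡ f x → f u ≡ f x → u ≢ x → u ≢ w →
                 let T = tree (x ∷ w ∷ R) in
                 LeafAt T x p → LeafAt T w q → LeafAt T u r →
                 lcp p q ⪯ lcp p r × ¬ (lcp p r ⪯ lcp p q)
  cherry-below uniq fw≡fx fu≡fx u≢x u≢w lx lw lu
    with p′ , refl , ix ← address-in-block (x ∷ w ∷ R) lx refl
    with q′ , refl , iw ← address-in-block (x ∷ w ∷ R) lw fw≡fx
    with r′ , refl , iu ← address-in-block (x ∷ w ∷ R) lu fu≡fx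
    with pq , pr ← blockTree-block-cherry uniq fw≡fx u≢x u≢w ix iw iu
    rewrite lcp-∷-≡ (toℕ (f x)) p′ q′ | lcp-∷-≡ (toℕ (f x)) p′ r′ | pq | pr =
    refl ∷ [] , λ { (_ ∷ ()) }

module _ {n k : ℕ} {C : Set} {E : Fin n → Fin n → Set} {σ : Fin n → C} {f : Fin n → Fin k}
         (coarse : CoarseGrains f (AhoConnected E σ)) where

  informative-same-block : ∀ {a b b′} → Informative E σ a b b′ → f a ≡ f b
  informative-same-block inf = coarse _ _ ((_ , inj₁ inf) ◅ ε)

  forbidden-same-block : ∀ {a b b′} → Forbidden E σ a b b′ → f b ≡ f b′
  forbidden-same-block forb = coarse _ _ ((_ , inj₂ (inj₂ (inj₁ forb))) ◅ ε)

  colour-class-avoids-block : ProperlyColoured E σ → ∀ {x y y′} → E x y → f x ≢ f y → σ y′ ≡ σ y →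
                              f x ≢ f y′
  colour-class-avoids-block proper {x} {y} {y′} exy fx≢fy σy′≡σy fx≡fy′ =
    ¬¬-excluded-middle λ where
      (yes exy′) → arc-to-y′ exy′
      (no ¬exy′) → fx≢fy (informative-same-block (proper x y exy , sym σy′≡σy , exy , ¬exy′))
    where
    arc-to-y′ : E x y′ → ⊥
    arc-to-y′ exy′ with y ≟ y′
    ... | yes refl = fx≢fy fx≡fy′
    ... | no  y≢y′ =
      fx≢fy (trans fx≡fy′
                   (sym (forbidden-same-block (proper x y exy , sym σy′≡σy , y≢y′ , exy , exy′))))

  arc-kept : ProperlyColoured E σ → ∀ {x y R} → x ∷ y ∷ R ↭ allFin n → E x y →
             BestMatch (PartitionTree.tree f (x ∷ y ∷ R)) σ x y
  arc-kept proper {x} {y} {R} listing exy = proper x y exy , lca-lowest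
    where
    open PartitionTree f (x ∷ y ∷ R)

    lca-lowest : ∀ y′ → σ y′ ≡ σ y → LcaLe tree x y y′
    lca-lowest y′ σy′≡σy {p} {q} {q′} lx ly ly′ with f x ≟ f y
    ... | no fx≢fy =
      let fx≢fy′ = colour-class-avoids-block proper exy fx≢fy σy′≡σy in
      subst₂ _⪯_ (sym (different-blocks-meet-at-root fx≢fy lx ly))
                 (sym (different-blocks-meet-at-root fx≢fy′ lx ly′)) []
    ... | yes fx≡fy with y′ ≟ y
    ...   | yes refl rewrite LeafAt-unique (OnV⇒Unique tree (tree-OnV listing)) ly ly′ = ⪯-refl _
    ...   | no y′≢y with y′ ≟ x
    ...     | yes refl = ⊥-elim (proper x y exy σy′≡σy)
    ...     | no y′≢x with f y′ ≟ f x
    ...       | yes fy′≡fx =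
      proj₁ (cherry-below f R (↭-allFin⇒Unique listing)
                          (sym fx≡fy) fy′≡fx y′≢x y′≢y lx ly ly′)
    ...       | no fy′≢fx =
      subst (lcp p q ⪯_) (sym (different-blocks-meet-at-root (fy′≢fx ∘ sym) lx ly′)) []

  closer-arc-excludes : IsDigraph E → ProperlyColoured E σ → Surj f → 2 ≤ k →
                        ∀ {x y m} → ¬ E x y → E x m → σ m ≡ σ y →
                        Σ (Tree n) λ T → InTV f T × ¬ BestMatch T σ x y
  closer-arc-excludes irreflexive proper surj 2≤k {x} {y} {m} ¬exy exm σm≡σy = by-block (f x ≟ f y)
    where
    fx≡fm : f x ≡ f m
    fx≡fm = informative-same-block (proper x m exm , σm≡σy , exm , ¬exy)

    cherry-x-m : ∀ {R} → x ∷ m ∷ R ↭ allFin n → f x ≡ f y →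
                 Σ (Tree n) λ T → InTV f T × ¬ BestMatch T σ x y
    cherry-x-m {R} listing fx≡fy =
      tree , tree-∈𝒯 surj 2≤k listing ,
      closer⇒¬BestMatch σ (tree-OnV listing) σm≡σy λ lx ly lm →
        proj₂ (cherry-below f R (↭-allFin⇒Unique listing) (sym fx≡fm) (sym fx≡fy)
                            (λ { refl → proper x m exm (sym σm≡σy) }) (λ { refl → ¬exy exm }) lx lm ly)
      where open PartitionTree f (x ∷ m ∷ R)

    by-block : Dec (f x ≡ f y) → Σ (Tree n) λ T → InTV f T × ¬ BestMatch T σ x y
    by-block (yes fx≡fy) = cherry-x-m (proj₂ (listing-starting-with λ { refl → irreflexive x exm })) fx≡fy
    by-block (no fx≢fy)  =
      tree , tree-∈𝒯 surj 2≤k ↭-refl ,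
      closer⇒¬BestMatch σ (tree-OnV ↭-refl) σm≡σy (other-block-farther fx≢fy fx≡fm)
      where open PartitionTree f (allFin n)

  non-arc-avoided : BinaryBMG E σ → Surj f → 2 ≤ k → ∀ {x y} → ¬ E x y →
                    ¬ ¬ (Σ (Tree n) λ T → InTV f T × ¬ BestMatch T σ x y)
  non-arc-avoided (irreflexive , proper , T , _ , _ , onV , arcs) surj 2≤k {x} {y} ¬exy avoided =
    ¬¬-excluded-middle λ where
      (yes σx≡σy) → avoided (tree , tree-∈𝒯 surj 2≤k ↭-refl , λ bm → proj₁ bm σx≡σy)
      (no  σx≢σy) → best-match-exists T σ onV x y σx≢σy λ (m , σm≡σy , best) →
        avoided (closer-arc-excludes irreflexive proper surj 2≤k ¬exy (proj₂ (arcs x m) best) σm≡σy)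
    where open PartitionTree f (allFin n)

lemma6 : {n : ℕ} {C : Set} (E : Fin n → Fin n → Set) (σ : Fin n → C) →
         2 ≤ n → BinaryBMG E σ →
         {k : ℕ} (f : Fin n → Fin k) → Surj f → 2 ≤ k →
         CoarseGrains f (AhoConnected E σ) →
         CostZero E σ f
lemma6 E σ _ bmg@(irreflexive , proper , _) f surj 2≤k coarse x y x-y∈U =
  ¬¬-excluded-middle λ where
    (yes exy) → arc exy
    (no ¬exy) → non-arc-avoided coarse bmg surj 2≤k ¬exy λ (T , T∈𝒯 , ¬bm) →
      [ (λ (exy , _) → ¬exy exy) , (λ (_ , bm) → ¬bm bm) ]′ (x-y∈U T T∈𝒯)
  where
  arc : E x y → ⊥
  arc exy with R , listing ← listing-starting-with (λ { refl → irreflexive x exy })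
    with x-y∈U (PartitionTree.tree f (x ∷ y ∷ R))
               (PartitionTree.tree-∈𝒯 f (x ∷ y ∷ R) surj 2≤k listing)
  ... | inj₁ (_ , ¬bm)   = ¬bm (arc-kept coarse proper listing exy)
  ... | inj₂ (¬exy , _) = ¬exy exy
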